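{- Write $\mathcal T_1$ for the class of $\lambda$-term-graphs over $\Sigma^\lambda_1$, and $\mathcal T_{ij}$ for the class of $\lambda$-term-graphs over $\Sigma^\lambda_{ij}$. A class $\mathcal K$ of term graphs over $\Sigma$ is closed under functional bisimulation if $G\in\mathcal K$ and a homomorphism $G\to G'$ (with $G'$ a term graph over $\Sigma$) imply $G'\in\mathcal K$. It is closed under converse functional bisimulation if $G\in\mathcal K$ and a homomorphism $G'\to G$ imply $G'\in\mathcal K$. Then: (i) For $j\in\{1,2\}$, $\mathcal T_{0j}$ is closed neither under functional bisimulation nor under converse functional bisimulation. (ii) None of $\mathcal T_1$, $\mathcal T_{11}$, $\mathcal T_{12}$ is closed under converse functional bisimulation. (iii) $\mathcal T_{11}$ is not closed under functional bisimulation. (iv) $\mathcal T_{12}$ is not closed under functional bisimulation.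
   Context: Term graphs. A term graph over a signature $\Sigma$ is a tuple $(V,\mathit{lab},\mathit{args},r)$, where: - $\mathit{args}(v)\in V^*$ has length equal to the arity of $\mathit{lab}(v)$; - every vertex is reachable from the root $r$. Write $w\rightarrowtail_kw'$ if $w'$ is the $k$-th entry (from $0$) of $\mathit{args}(w)$. Homomorphisms. A homomorphism $h:G_1\to G_2$ satisfies $h(r_1)=r_2$, preserves labels, and has $\mathit{args}_2(h(v))=\bar h(\mathit{args}_1(v))$ (letterwise extension). Notation. $\Sigma^\lambda_1=\{@,\lambda,0\}$ with arities $2,1,1$. $\Sigma^\lambda_{ij}=\{@,\lambda,0,S\}$ with arities $2,1,i,j$ ($i\in\{0,1\}$, $j\in\{1,2\}$). For words: $\epsilon$ is empty, juxtaposition is concatenation, $\le$ is the prefix order. $\lambda$-term-graphs over $\Sigma^\lambda_1$. A term graph over $\Sigma^\lambda_1$ is a $\lambda$-term-graph if it admits $P:V\to V^*$ with: - $P(r)=\epsilon$; - $\lambda$-vertex $w\rightarrowtail_0w_0$ implies $P(w_0)\le P(w)w$; - $@$-vertex $w\rightarrowtail_kw_k$ implies $P(w_k)\le P(w)$; - $0$-vertex $w$ implies $P(w)\ne\epsilon$; - $0$-vertex $w\rightarrowtail_0w_0$ implies $w_0$ labelled $\lambda$ and $P(w_0)w_0=P(w)$. $\lambda$-term-graphs over $\Sigma^\lambda_{ij}$. A term graph over $\Sigma^\lambda_{ij}$ is a $\lambda$-term-graph if it admits $P:V\to V^*$ with: - $P(r)=\epsilon$; - $\lambda$-vertex $w\rightarrowtail_0w_0$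 implies $P(w_0)=P(w)w$; - $@$-vertex $w\rightarrowtail_kw_k$ implies $P(w_k)=P(w)$; - $0$-vertex $w$ implies $P(w)\neq\epsilon$; - $0$-vertex $w\rightarrowtail_0w_0$ implies $w_0$ labelled $\lambda$ and $P(w_0)w_0=P(w)$; - $S$-vertex $w\rightarrowtail_0w_0$ implies $P(w_0)v=P(w)$ for some $v$; - $S$-vertex $w\rightarrowtail_1w_1$ implies $w_1$ labelled $\lambda$ and $P(w_1)w_1=P(w)$. -}

module Defs where

open import Data.Nat using (ℕ; zero; suc)
open import Data.Fin using (Fin)
open import Data.List using (List; []; _∷_; _++_; [_]; length; map)
open import Data.Product using (Σ; _×_; ∃)
open import Relation.Binary.PropositionalEquality using (_≡_; _≢_)
open import Relation.Binary.Construct.Closure.ReflexiveTransitive using (Star)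
open import Relation.Nullary using (¬_)

record Signature : Set₁ where
  field
    Sym   : Set
    arity : Sym → ℕ
open Signature public

data At {A : Set} : List A → ℕ → A → Set where
  here  : ∀ {x xs} → At (x ∷ xs) zero x
  there : ∀ {x xs k y} → At xs k y → At (x ∷ xs) (suc k) y

_≼_ : {A : Set} → List A → List A → Set
xs ≼ ys = ∃ λ zs → xs ++ zs ≡ ys

record TermGraph (Σ' : Signature) : Set where
  field
    n     : ℕ
    lab   : Fin n → Sym Σ'
    args  : Fin n → List (Fin n)
    args-len : ∀ v → length (args v) ≡ arity Σ' (lab v)
    root  : Fin n
  _↣[_]_ : Fin n → ℕ → Fin n → Set
  w ↣[ k ] w' = At (args w) k w'
  Edge : Fin n → Fin n → Set
  Edge w w' = ∃ λ k → w ↣[ k ] w'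
  field
    reachable : ∀ v → Star Edge root v

record Hom {Σ' : Signature} (G₁ G₂ : TermGraph Σ') : Set where
  module G₁ = TermGraph G₁
  module G₂ = TermGraph G₂
  field
    h        : Fin G₁.n → Fin G₂.n
    h-root   : h G₁.root ≡ G₂.root
    h-lab    : ∀ v → G₂.lab (h v) ≡ G₁.lab v
    h-args   : ∀ v → G₂.args (h v) ≡ map h (G₁.args v)

ClosedUnderFunBisim : {Σ' : Signature} → (TermGraph Σ' → Set) → Set
ClosedUnderFunBisim {Σ'} K = (G G' : TermGraph Σ') → K G → Hom G G' → K G'

ClosedUnderConvFunBisim : {Σ' : Signature} → (TermGraph Σ' → Set) → Set
ClosedUnderConvFunBisim {Σ'} K = (G G' : TermGraph Σ') → K G → Hom G' G → K G'

-- Σ^λ_1 = {@, λ, 0} with arities 2, 1, 1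

data Sym1 : Set where
  app lam var : Sym1

arity1 : Sym1 → ℕ
arity1 app = 2
arity1 lam = 1
arity1 var = 1

Σλ₁ : Signature
Σλ₁ = record { Sym = Sym1 ; arity = arity1 }

record IsλTG₁ (G : TermGraph Σλ₁) : Set where
  open TermGraph G
  field
    P      : Fin n → List (Fin n)
    P-root : P root ≡ []
    P-lam  : ∀ w w₀ → lab w ≡ lam → w ↣[ 0 ] w₀ → P w₀ ≼ (P w ++ [ w ])
    P-app  : ∀ w k wₖ → lab w ≡ app → w ↣[ k ] wₖ → P wₖ ≼ P w
    P-var  : ∀ w → lab w ≡ var → P w ≢ []
    P-var₀ : ∀ w w₀ → lab w ≡ var → w ↣[ 0 ] w₀ → (lab w₀ ≡ lam) × (P w₀ ++ [ w₀ ] ≡ P w)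

T₁ : TermGraph Σλ₁ → Set
T₁ = IsλTG₁

-- Σ^λ_ij = {@, λ, 0, S} with arities 2, 1, i, j

data SymS : Set where
  app lam var S : SymS

arityS : ℕ → ℕ → SymS → ℕ
arityS i j app = 2
arityS i j lam = 1
arityS i j var = i
arityS i j S   = j

Σλ : ℕ → ℕ → Signature
Σλ i j = record { Sym = SymS ; arity = arityS i j }

record IsλTG (i j : ℕ) (G : TermGraph (Σλ i j)) : Set where
  open TermGraph G
  field
    P      : Fin n → List (Fin n)
    P-root : P root ≡ []
    P-lam  : ∀ w w₀ → lab w ≡ lam → w ↣[ 0 ] w₀ → P w₀ ≡ P w ++ [ w ]
    P-app  : ∀ w k wₖ → lab w ≡ app → w ↣[ k ] wₖ → P wₖ ≡ P w
    P-var  : ∀ w → lab w ≡ var → P w ≢ []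
    P-var₀ : ∀ w w₀ → lab w ≡ var → w ↣[ 0 ] w₀ → (lab w₀ ≡ lam) × (P w₀ ++ [ w₀ ] ≡ P w)
    P-S₀   : ∀ w w₀ → lab w ≡ S → w ↣[ 0 ] w₀ → ∃ λ v → P w₀ ++ [ v ] ≡ P w
    P-S₁   : ∀ w w₁ → lab w ≡ S → w ↣[ 1 ] w₁ → (lab w₁ ≡ lam) × (P w₁ ++ [ w₁ ] ≡ P w)

T : (i j : ℕ) → TermGraph (Σλ i j) → Set
T i j = IsλTG i j

-- In a λ-term-graph the scope function P is forced by the graph: over Σ^λ_ij it is
-- constant along @-edges and grows by exactly the binder along λ-edges.  Hence a
-- vertex cannot be shared between the outside and the inside of a λ (so merging
-- such vertices, a functional bisimulation, leaves the class), and two distinct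
-- λ-vertices cannot share a body (so unsharing a λ, a converse functional
-- bisimulation, leaves the class).  Over Σ^λ_1 the @- and λ-conditions only
-- bound P by a prefix, but a variable pins its scope to its binder, so a variable
-- body shared by two λ-vertices at the same level still forces them to coincide.
-- All counterexamples use only @ and λ (and 0 over Σ^λ_1), so they work for every
-- choice of arities i, j.
module Submission where

open import Defs
open import Data.Product using (_×_; _,_; proj₁; proj₂)
open import Relation.Nullary using (¬_)
open import Data.Nat using (ℕ)
open import Data.Fin using (Fin; zero; suc)
open import Data.List using (List; []; _∷_; _++_; [_])
open import Data.List.Properties using (∷-injectiveˡ; ∷ʳ-injectiveʳ; ++-conicalˡ; ++-conicalʳ; ++-cancelˡ; ++-assoc)
open import Relation.Binary.PropositionalEquality using (_≡_; _≢_; refl; sym; trans; cong; module ≡-Reasoning)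
open import Relation.Binary.Construct.Closure.ReflexiveTransitive using (ε; _◅_)

pattern f0 = zero
pattern f1 = suc zero
pattern f2 = suc (suc zero)
pattern f3 = suc (suc (suc zero))

module Scope {i j : ℕ} {G : TermGraph (Σλ i j)} (t : IsλTG i j G) where
  open TermGraph G
  open IsλTG t

  app-child-of-root-scope≡[] : ∀ {k c} → lab root ≡ app → root ↣[ k ] c → P c ≡ []
  app-child-of-root-scope≡[] r-app r↣c = trans (P-app _ _ _ r-app r↣c) P-root

  lam-body-scope≢[] : ∀ {l b} → lab l ≡ lam → l ↣[ 0 ] b → P b ≢ []
  lam-body-scope≢[] {l} l-lam l↣b Pb≡[]
    with ++-conicalʳ (P l) [ l ] (trans (sym (P-lam _ _ l-lam l↣b)) Pb≡[])
  ... | ()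

  lam-body-injective : ∀ {l₁ l₂ b} → lab l₁ ≡ lam → lab l₂ ≡ lam →
                       l₁ ↣[ 0 ] b → l₂ ↣[ 0 ] b → l₁ ≡ l₂
  lam-body-injective {l₁} {l₂} l₁-lam l₂-lam l₁↣b l₂↣b =
    ∷ʳ-injectiveʳ (P l₁) (P l₂)
      (trans (sym (P-lam _ _ l₁-lam l₁↣b)) (P-lam _ _ l₂-lam l₂↣b))

module Scope₁ {G : TermGraph Σλ₁} (t : IsλTG₁ G) where
  open TermGraph G
  open IsλTG₁ t

  app-child-of-root-scope≡[] : ∀ {k c} → lab root ≡ app → root ↣[ k ] c → P c ≡ []
  app-child-of-root-scope≡[] {c = c} r-app r↣c =
    let (zs , Pc++zs≡Pr) = P-app _ _ _ r-app r↣c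
    in ++-conicalˡ (P c) zs (trans Pc++zs≡Pr P-root)

  var-body-bound-by-its-lam : ∀ {v l₁ l₂} → lab v ≡ var → v ↣[ 0 ] l₁ →
                              lab l₂ ≡ lam → l₂ ↣[ 0 ] v → P l₁ ≡ P l₂ → l₁ ≡ l₂
  var-body-bound-by-its-lam {v} {l₁} {l₂} v-var v↣l₁ l₂-lam l₂↣v Pl₁≡Pl₂ =
    ∷-injectiveˡ (++-cancelˡ (P l₂) (l₁ ∷ zs) [ l₂ ] same-level)
    where
      open ≡-Reasoning
      zs : List (Fin n)
      zs = proj₁ (P-lam _ _ l₂-lam l₂↣v)
      same-level : P l₂ ++ (l₁ ∷ zs) ≡ P l₂ ++ [ l₂ ]
      same-level = begin
        P l₂ ++ (l₁ ∷ zs)      ≡⟨ cong (_++ (l₁ ∷ zs)) (sym Pl₁≡Pl₂) ⟩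
        P l₁ ++ ([ l₁ ] ++ zs) ≡⟨ sym (++-assoc (P l₁) [ l₁ ] zs) ⟩
        (P l₁ ++ [ l₁ ]) ++ zs ≡⟨ cong (_++ zs) (proj₂ (P-var₀ _ _ v-var v↣l₁)) ⟩
        P v ++ zs              ≡⟨ proj₂ (P-lam _ _ l₂-lam l₂↣v) ⟩
        P l₂ ++ [ l₂ ]         ∎

-- r = @(c, l), l = λ c′ with @-loops c and c′; merging c′ into c puts c both
-- outside and inside the scope of l.
module ScopeMerging (i j : ℕ) where
  labSeparate : Fin 4 → SymS
  labSeparate f0 = app
  labSeparate f1 = app
  labSeparate f2 = lam
  labSeparate f3 = app

  argsSeparate : Fin 4 → List (Fin 4)
  argsSeparate f0 = f1 ∷ f2 ∷ []
  argsSeparate f1 = f1 ∷ f1 ∷ []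
  argsSeparate f2 = f3 ∷ []
  argsSeparate f3 = f3 ∷ f3 ∷ []

  separate : TermGraph (Σλ i j)
  separate = record
    { n = 4 ; lab = labSeparate ; args = argsSeparate
    ; args-len = λ { f0 → refl ; f1 → refl ; f2 → refl ; f3 → refl }
    ; root = f0
    ; reachable = λ { f0 → ε
                    ; f1 → (0 , here) ◅ ε
                    ; f2 → (1 , there here) ◅ ε
                    ; f3 → (1 , there here) ◅ (0 , here) ◅ ε } }

  labMerged : Fin 3 → SymS
  labMerged f0 = app
  labMerged f1 = app
  labMerged f2 = lam

  argsMerged : Fin 3 → List (Fin 3)
  argsMerged f0 = f1 ∷ f2 ∷ []
  argsMerged f1 = f1 ∷ f1 ∷ []
  argsMerged f2 = f1 ∷ []

  merged : TermGraph (Σλ i j)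
  merged = record
    { n = 3 ; lab = labMerged ; args = argsMerged
    ; args-len = λ { f0 → refl ; f1 → refl ; f2 → refl }
    ; root = f0
    ; reachable = λ { f0 → ε
                    ; f1 → (0 , here) ◅ ε
                    ; f2 → (1 , there here) ◅ ε } }

  merge : Fin 4 → Fin 3
  merge f0 = f0
  merge f1 = f1
  merge f2 = f2
  merge f3 = f1

  merge-hom : Hom separate merged
  merge-hom = record
    { h = merge ; h-root = refl
    ; h-lab = λ { f0 → refl ; f1 → refl ; f2 → refl ; f3 → refl }
    ; h-args = λ { f0 → refl ; f1 → refl ; f2 → refl ; f3 → refl } }

  scopeSeparate : Fin 4 → List (Fin 4)
  scopeSeparate f3 = f2 ∷ []
  scopeSeparate _  = []

  separate-λTG : T i j separate
  separate-λTG = record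
    { P = scopeSeparate ; P-root = refl
    ; P-lam = λ { f2 .f3 refl here → refl ; f0 _ () _ ; f1 _ () _ ; f3 _ () _ }
    ; P-app = λ { f0 .0 .f1 refl here → refl
                ; f0 .1 .f2 refl (there here) → refl
                ; f1 .0 .f1 refl here → refl
                ; f1 .1 .f1 refl (there here) → refl
                ; f3 .0 .f3 refl here → refl
                ; f3 .1 .f3 refl (there here) → refl
                ; f0 _ _ refl (there (there ()))
                ; f1 _ _ refl (there (there ()))
                ; f3 _ _ refl (there (there ())) }
    ; P-var = λ { f0 () ; f1 () ; f2 () ; f3 () }
    ; P-var₀ = λ { f0 _ () ; f1 _ () ; f2 _ () ; f3 _ () }
    ; P-S₀ = λ { f0 _ () ; f1 _ () ; f2 _ () ; f3 _ () }
    ; P-S₁ = λ { f0 _ () ; f1 _ () ; f2 _ () ; f3 _ () } }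

  merged-not-λTG : ¬ T i j merged
  merged-not-λTG t =
    lam-body-scope≢[] {f2} refl here (app-child-of-root-scope≡[] {0} refl here)
    where open Scope t

  ¬closed : ¬ ClosedUnderFunBisim (T i j)
  ¬closed closed = merged-not-λTG (closed separate merged separate-λTG merge-hom)

-- r = @(l, l), l = λ c with an @-loop c; the unfolding r = @(l₁, l₂) has two
-- λ-vertices with the common body c.
module BinderSplitting (i j : ℕ) where
  labShared : Fin 3 → SymS
  labShared f0 = app
  labShared f1 = lam
  labShared f2 = app

  argsShared : Fin 3 → List (Fin 3)
  argsShared f0 = f1 ∷ f1 ∷ []
  argsShared f1 = f2 ∷ []
  argsShared f2 = f2 ∷ f2 ∷ []

  shared : TermGraph (Σλ i j)
  shared = record
    { n = 3 ; lab = labShared ; args = argsShared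
    ; args-len = λ { f0 → refl ; f1 → refl ; f2 → refl }
    ; root = f0
    ; reachable = λ { f0 → ε
                    ; f1 → (0 , here) ◅ ε
                    ; f2 → (0 , here) ◅ (0 , here) ◅ ε } }

  labSplit : Fin 4 → SymS
  labSplit f0 = app
  labSplit f1 = lam
  labSplit f2 = lam
  labSplit f3 = app

  argsSplit : Fin 4 → List (Fin 4)
  argsSplit f0 = f1 ∷ f2 ∷ []
  argsSplit f1 = f3 ∷ []
  argsSplit f2 = f3 ∷ []
  argsSplit f3 = f3 ∷ f3 ∷ []

  split : TermGraph (Σλ i j)
  split = record
    { n = 4 ; lab = labSplit ; args = argsSplit
    ; args-len = λ { f0 → refl ; f1 → refl ; f2 → refl ; f3 → refl }
    ; root = f0
    ; reachable = λ { f0 → ε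
                    ; f1 → (0 , here) ◅ ε
                    ; f2 → (1 , there here) ◅ ε
                    ; f3 → (0 , here) ◅ (0 , here) ◅ ε } }

  unsplit : Fin 4 → Fin 3
  unsplit f0 = f0
  unsplit f1 = f1
  unsplit f2 = f1
  unsplit f3 = f2

  unsplit-hom : Hom split shared
  unsplit-hom = record
    { h = unsplit ; h-root = refl
    ; h-lab = λ { f0 → refl ; f1 → refl ; f2 → refl ; f3 → refl }
    ; h-args = λ { f0 → refl ; f1 → refl ; f2 → refl ; f3 → refl } }

  scopeShared : Fin 3 → List (Fin 3)
  scopeShared f2 = f1 ∷ []
  scopeShared _  = []

  shared-λTG : T i j shared
  shared-λTG = record
    { P = scopeShared ; P-root = refl
    ; P-lam = λ { f1 .f2 refl here → refl ; f0 _ () _ ; f2 _ () _ }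
    ; P-app = λ { f0 .0 .f1 refl here → refl
                ; f0 .1 .f1 refl (there here) → refl
                ; f2 .0 .f2 refl here → refl
                ; f2 .1 .f2 refl (there here) → refl
                ; f0 _ _ refl (there (there ()))
                ; f2 _ _ refl (there (there ())) }
    ; P-var = λ { f0 () ; f1 () ; f2 () }
    ; P-var₀ = λ { f0 _ () ; f1 _ () ; f2 _ () }
    ; P-S₀ = λ { f0 _ () ; f1 _ () ; f2 _ () }
    ; P-S₁ = λ { f0 _ () ; f1 _ () ; f2 _ () } }

  split-not-λTG : ¬ T i j split
  split-not-λTG t with lam-body-injective {f1} {f2} refl refl here here
    where open Scope t
  ... | ()

  ¬closed : ¬ ClosedUnderConvFunBisim (T i j)
  ¬closed closed = split-not-λTG (closed shared split shared-λTG unsplit-hom)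

-- r = @(l, l), l = λ v, v = 0(l); the unfolding r = @(l₁, l₂) has the common
-- body v of l₁ and l₂ bound by l₁ only.
module BinderSplitting₁ where
  labShared : Fin 3 → Sym1
  labShared f0 = app
  labShared f1 = lam
  labShared f2 = var

  argsShared : Fin 3 → List (Fin 3)
  argsShared f0 = f1 ∷ f1 ∷ []
  argsShared f1 = f2 ∷ []
  argsShared f2 = f1 ∷ []

  shared : TermGraph Σλ₁
  shared = record
    { n = 3 ; lab = labShared ; args = argsShared
    ; args-len = λ { f0 → refl ; f1 → refl ; f2 → refl }
    ; root = f0
    ; reachable = λ { f0 → ε
                    ; f1 → (0 , here) ◅ ε
                    ; f2 → (0 , here) ◅ (0 , here) ◅ ε } }

  labSplit : Fin 4 → Sym1
  labSplit f0 = app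
  labSplit f1 = lam
  labSplit f2 = lam
  labSplit f3 = var

  argsSplit : Fin 4 → List (Fin 4)
  argsSplit f0 = f1 ∷ f2 ∷ []
  argsSplit f1 = f3 ∷ []
  argsSplit f2 = f3 ∷ []
  argsSplit f3 = f1 ∷ []

  split : TermGraph Σλ₁
  split = record
    { n = 4 ; lab = labSplit ; args = argsSplit
    ; args-len = λ { f0 → refl ; f1 → refl ; f2 → refl ; f3 → refl }
    ; root = f0
    ; reachable = λ { f0 → ε
                    ; f1 → (0 , here) ◅ ε
                    ; f2 → (1 , there here) ◅ ε
                    ; f3 → (0 , here) ◅ (0 , here) ◅ ε } }

  unsplit : Fin 4 → Fin 3
  unsplit f0 = f0
  unsplit f1 = f1
  unsplit f2 = f1
  unsplit f3 = f2

  unsplit-hom : Hom split shared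
  unsplit-hom = record
    { h = unsplit ; h-root = refl
    ; h-lab = λ { f0 → refl ; f1 → refl ; f2 → refl ; f3 → refl }
    ; h-args = λ { f0 → refl ; f1 → refl ; f2 → refl ; f3 → refl } }

  scopeShared : Fin 3 → List (Fin 3)
  scopeShared f2 = f1 ∷ []
  scopeShared _  = []

  shared-λTG : T₁ shared
  shared-λTG = record
    { P = scopeShared ; P-root = refl
    ; P-lam = λ { f1 .f2 refl here → [] , refl ; f0 _ () _ ; f2 _ () _ }
    ; P-app = λ { f0 .0 .f1 refl here → [] , refl
                ; f0 .1 .f1 refl (there here) → [] , refl
                ; f0 _ _ refl (there (there ()))
                ; f1 _ _ () _ ; f2 _ _ () _ }
    ; P-var = λ { f2 refl () }
    ; P-var₀ = λ { f2 .f1 refl here → refl , refl } }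

  split-not-λTG : ¬ T₁ split
  split-not-λTG t
    with var-body-bound-by-its-lam {f3} {f1} {f2} refl here refl here
           (trans (app-child-of-root-scope≡[] {0} refl here)
                  (sym (app-child-of-root-scope≡[] {1} refl (there here))))
    where open Scope₁ t
  ... | ()

  ¬closed : ¬ ClosedUnderConvFunBisim T₁
  ¬closed closed = split-not-λTG (closed shared split shared-λTG unsplit-hom)

proposition6p2 :
    ((¬ ClosedUnderFunBisim (T 0 1)) × (¬ ClosedUnderConvFunBisim (T 0 1))
      × (¬ ClosedUnderFunBisim (T 0 2)) × (¬ ClosedUnderConvFunBisim (T 0 2)))
    × ((¬ ClosedUnderConvFunBisim T₁) × (¬ ClosedUnderConvFunBisim (T 1 1))
      × (¬ ClosedUnderConvFunBisim (T 1 2)))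
    × (¬ ClosedUnderFunBisim (T 1 1))
    × (¬ ClosedUnderFunBisim (T 1 2))
proposition6p2 =
  ( (ScopeMerging.¬closed 0 1 , BinderSplitting.¬closed 0 1
    , ScopeMerging.¬closed 0 2 , BinderSplitting.¬closed 0 2)
  , (BinderSplitting₁.¬closed , BinderSplitting.¬closed 1 1 , BinderSplitting.¬closed 1 2)
  , ScopeMerging.¬closed 1 1
  , ScopeMerging.¬closed 1 2 )
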